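{- ${>_{\mathrm{horpo}}}\subseteq(>_{\mathrm{horco}})^+$, where $(>_{\mathrm{horco}})^+$ denotes the transitive closure of $>_{\mathrm{horco}}$.
   Context: Simple types over base types $\mathcal{B}$ ($T::=B\mid T\Rightarrow U$; every type is $T_1\Rightarrow\dots\Rightarrow T_n\Rightarrow B$), variables $\mathcal{X}$ (infinitely many per type) and function symbols $\mathcal{F}$ each with a type; simply typed $\lambda$-terms up to $\alpha$-conversion; $\mathrm{FV}$ free variables; $f\vec t=ft_1\dots t_n$; for a sequence $\vec u=u_1,\dots,u_n$, the term $\vec u$ means the application $u_1u_2\dots u_n$. For $g:T_1\Rightarrow\dots\Rightarrow T_n\Rightarrow B$, $\mathrm{Acc}(g)=\{i\mid T_i\in\mathcal{B}\}$. Fix a quasi-ordering $\ge_{\mathcal{F}}$ on $\mathcal{F}$ with well-founded strict part $>_{\mathcal{F}}$ and equivalence $\simeq_{\mathcal{F}}$, and statuses $\mathrm{stat}_f\in\{\mathrm{lex},\mathrm{mul}\}$ equal on $\simeq_{\mathcal{F}}$-classes; for a relation $\rhd$, $(\rhd)_{\mathrm{stat}_f}$ is its lexicographic extension if $\mathrm{stat}_f=\mathrm{lex}$ and its multiset extension if $\mathrm{stat}_f=\mathrm{mul}$; $(\rhd)_{\mathrm{mul}}$ is the multiset extension. HORCO: the relations $>_{\mathrm{whorco}}$, $>_{\mathrm{horco}}$ and an auxiliary relation $>$ (whose left-hand sides have the form $f\vec l$) are the least relations closed under: (cont) if $t>_{\mathrm{whorco}}u$ then $C[t]>_{\mathrm{horco}}C[u]$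 for every context $C$ (term with one hole, possibly the empty context); (rule) if $t:T$, $u:T$, $t>u$ and $\mathrm{FV}(u)\subseteq\mathrm{FV}(t)$, then $t>_{\mathrm{whorco}}u$; (arg) $f\vec l>l_i$; (decomp-symb) if $f\vec l>g\vec u$ and $i\in\mathrm{Acc}(g)$ then $f\vec l>u_i$; (prec) if $f>_{\mathcal{F}}g$ then $f\vec l>g$; (call) if $f\simeq_{\mathcal{F}}g:\vec U\Rightarrow U$, $\vec u:\vec U$, $f\vec l>u_i$ for all $i$, and $\vec l\,(>_{\mathrm{whorco}})_{\mathrm{stat}_f}\,\vec u$, then $f\vec l>g\vec u$; (call') the same with $\vec l\,(>_{\mathrm{horco}})_{\mathrm{stat}_f}\,\vec u$ in place of $\vec l\,(>_{\mathrm{whorco}})_{\mathrm{stat}_f}\,\vec u$; (app) if $f\vec l>u$ with $u:V\Rightarrow T$ and $f\vec l>v$ with $v:V$ then $f\vec l>uv$; (var) if $x\notin\mathrm{FV}(\vec l)$ then $f\vec l>x$; (lam) if $f\vec l>u$ and $x\notin\mathrm{FV}(\vec l)$ then $f\vec l>\lambda xu$; (red) if $f\vec l>u$ and $u>_{\mathrm{horco}}v$ then $f\vec l>v$. HORPO (monomorphic): $>_{\mathrm{horpo}}$ is the least relation closed under the rules below, where $\ge_{\mathrm{horpo}}$ is its reflexive closure and $P(f,\vec t,u)$ abbreviates "$f\vec t>_{\mathrm{horpo}}u$ or $t_j\ge_{\mathrm{horpo}}u$ for some $j$", and $P(f,\vec t,\vec u)$ means $P(f,\vec t,u_i)$ for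 all $i$: (1) if $f:\vec T\Rightarrow T$, $\vec t:\vec T$, $u:T$ and $t_i\ge_{\mathrm{horpo}}u$ for some $i$, then $f\vec t>_{\mathrm{horpo}}u$; (2) if $f:\vec T\Rightarrow T$, $g:\vec U\Rightarrow T$, $\vec t:\vec T$, $\vec u:\vec U$, $f>_{\mathcal{F}}g$ and $P(f,\vec t,\vec u)$, then $f\vec t>_{\mathrm{horpo}}g\vec u$; (3) same typing, $f\simeq_{\mathcal{F}}g$, $\mathrm{stat}_f=\mathrm{mul}$ and $\vec t\,(>_{\mathrm{horpo}})_{\mathrm{stat}_f}\,\vec u$, then $f\vec t>_{\mathrm{horpo}}g\vec u$; (4) same typing, $f\simeq_{\mathcal{F}}g$, $\mathrm{stat}_f=\mathrm{lex}$, $\vec t\,(>_{\mathrm{horpo}})_{\mathrm{stat}_f}\,\vec u$ and $P(f,\vec t,\vec u)$, then $f\vec t>_{\mathrm{horpo}}g\vec u$; (5) if $f:\vec T\Rightarrow T$, $\vec t:\vec T$, the application $u_1\dots u_n$ has type $T$ and $P(f,\vec t,\vec u)$, then $f\vec t>_{\mathrm{horpo}}u_1\dots u_n$; (6) if $t_1:U\Rightarrow T$, $t_2:U$, $u_1:V\Rightarrow T$, $u_2:V$ and $\{t_1,t_2\}\,(>_{\mathrm{horpo}})_{\mathrm{mul}}\,\{u_1,u_2\}$, then $t_1t_2>_{\mathrm{horpo}}u_1u_2$; (7) if $t>_{\mathrm{horpo}}u$ then $\lambda xt>_{\mathrm{horpo}}\lambda xu$. -}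

module Defs where

open import Data.Empty using (⊥)
open import Data.Product using (Σ; Σ-syntax; ∃; _×_; _,_)
open import Data.Sum using (_⊎_)
open import Data.List using (List; []; _∷_; _++_)
open import Data.List.Membership.Propositional using (_∈_)
open import Data.List.Relation.Unary.Any using (here; there)
open import Data.List.Relation.Unary.All as All using (All; []; _∷_)
open import Data.List.Relation.Unary.Any as Any using (Any)
open import Data.List.Relation.Binary.Permutation.Propositional using (_↭_)
open import Relation.Nullary using (¬_)
open import Relation.Binary.PropositionalEquality using (_≡_)
open import Relation.Binary.Structures using (IsPreorder)
open import Induction.WellFounded using (WellFounded)
open import Function using (flip)

infixr 7 _⇒_
data Ty (B : Set) : Set where
  base : B → Ty B
  _⇒_  : Ty B → Ty B → Ty B

data IsBase {B : Set} : Ty B → Set where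
  isBase : (b : B) → IsBase (base b)

data Status : Set where
  lex mul : Status

Strict : {A : Set} → (A → A → Set) → A → A → Set
Strict _≥_ f g = f ≥ g × ¬ (g ≥ f)

Equiv : {A : Set} → (A → A → Set) → A → A → Set
Equiv _≥_ f g = f ≥ g × g ≥ f

data LexExt {A : Set} (R : A → A → Set) : List A → List A → Set where
  lex-here  : ∀ {x y xs ys} → R x y → LexExt R (x ∷ xs) (y ∷ ys)
  lex-there : ∀ {x xs ys} → LexExt R xs ys → LexExt R (x ∷ xs) (x ∷ ys)

-- multiset extension (Dershowitz–Manna), multisets represented by lists
-- up to permutation:  M > N iff M = Z + X, N = Z + Y, X ≠ ∅ and every
-- element of Y is smaller than some element of X
data MulExt {A : Set} (R : A → A → Set) (M N : List A) : Set where
  mulExt : (x : A) (X Y Z : List A) →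
           M ↭ (Z ++ (x ∷ X)) → N ↭ (Z ++ Y) →
           All (λ y → Any (λ x′ → R x′ y) (x ∷ X)) Y →
           MulExt R M N

data StatExt {A : Set} (R : A → A → Set) : Status → List A → List A → Set where
  stat-lex : ∀ {xs ys} → LexExt R xs ys → StatExt R lex xs ys
  stat-mul : ∀ {xs ys} → MulExt R xs ys → StatExt R mul xs ys

record Signature : Set₁ where
  field
    Base  : Set
    Sym   : Set
    type  : Sym → Ty Base
    _≥F_  : Sym → Sym → Set
    ≥F-isPreorder : IsPreorder _≡_ _≥F_
    >F-wellFounded : WellFounded (flip (Strict _≥F_))
    stat  : Sym → Status
    stat-compat : ∀ {f g} → Equiv _≥F_ f g → stat f ≡ stat g

module Theory (S : Signature) where
  open Signature S

  _>F_ : Sym → Sym → Set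
  _>F_ = Strict _≥F_

  _≃F_ : Sym → Sym → Set
  _≃F_ = Equiv _≥F_

  Type : Set
  Type = Ty Base

  Ctx : Set
  Ctx = List Type

  -- Simply typed λ-terms (de Bruijn, so α-equivalence is equality).
  -- A term  Tm Γ T  has its free variables among the typed variables Γ.

  data Tm (Γ : Ctx) : Type → Set where
    var : ∀ {A} → A ∈ Γ → Tm Γ A
    fun : (f : Sym) → Tm Γ (type f)
    app : ∀ {A B} → Tm Γ (A ⇒ B) → Tm Γ A → Tm Γ B
    lam : ∀ {A B} → Tm (A ∷ Γ) B → Tm Γ (A ⇒ B)

  Tm∃ : Ctx → Set
  Tm∃ Γ = Σ Type (Tm Γ)

  data Split : Type → List Type → Type → Set where
    done : ∀ {T} → Split T [] T
    arg  : ∀ {A U Ts T} → Split U Ts T → Split (A ⇒ U) (A ∷ Ts) T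

  Args : Ctx → List Type → Set
  Args Γ = All (Tm Γ)

  appS : ∀ {Γ U Ts T} → Tm Γ U → Split U Ts T → Args Γ Ts → Tm Γ T
  appS t done       []       = t
  appS t (arg s)    (u ∷ us) = appS (app t u) s us

  toList : ∀ {Γ Ts} → Args Γ Ts → List (Tm∃ Γ)
  toList []       = []
  toList (t ∷ ts) = (_ , t) ∷ toList ts

  data _∈FV_ {Γ : Ctx} {A : Type} (x : A ∈ Γ) : ∀ {T} → Tm Γ T → Set where
    fv-var  : x ∈FV var x
    fv-appl : ∀ {B C} {t : Tm Γ (B ⇒ C)} {u} → x ∈FV t → x ∈FV app t u
    fv-appr : ∀ {B C} {t : Tm Γ (B ⇒ C)} {u} → x ∈FV u → x ∈FV app t u
    fv-lam  : ∀ {B C} {t : Tm (B ∷ Γ) C} → there x ∈FV t → x ∈FV lam t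

  _∈FVs_ : ∀ {Γ A Ts} → A ∈ Γ → Args Γ Ts → Set
  _∈FVs_ {Ts = Ts} x ts = Σ[ B ∈ Type ] Σ[ p ∈ B ∈ Ts ] x ∈FV All.lookup ts p

  ext : ∀ {Γ Δ : Ctx} {B : Type} → (∀ {A : Type} → A ∈ Γ → A ∈ Δ) →
        ∀ {A : Type} → A ∈ (B ∷ Γ) → A ∈ (B ∷ Δ)
  ext ρ (here p)  = here p
  ext ρ (there x) = there (ρ x)

  ren : ∀ {Γ Δ : Ctx} → (∀ {A : Type} → A ∈ Γ → A ∈ Δ) → ∀ {T} → Tm Γ T → Tm Δ T
  ren ρ (var x)   = var (ρ x)
  ren ρ (fun f)   = fun f
  ren ρ (app t u) = app (ren ρ t) (ren ρ u)
  ren ρ (lam t)   = lam (ren (ext ρ) t)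

  wk : ∀ {Γ B T} → Tm Γ T → Tm (B ∷ Γ) T
  wk = ren there

  wkArgs : ∀ {Γ B Ts} → Args Γ Ts → Args (B ∷ Γ) Ts
  wkArgs = All.map wk

  infix 4 _>whorco_ _>horco_

  data _>whorco_ : ∀ {Γ T} → Tm Γ T → Tm Γ T → Set
  data _>horco_  : ∀ {Γ T} → Tm Γ T → Tm Γ T → Set
  -- Gt f s l u  :  f l⃗ > u   (the auxiliary relation >)
  data Gt : ∀ {Γ} (f : Sym) {Ts T} → Split (type f) Ts T → Args Γ Ts →
            ∀ {U} → Tm Γ U → Set
  data W∃ {Γ : Ctx} : Tm∃ Γ → Tm∃ Γ → Set
  data C∃ {Γ : Ctx} : Tm∃ Γ → Tm∃ Γ → Set

  data W∃ {Γ} where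
    w∃ : ∀ {T} {t u : Tm Γ T} → t >whorco u → W∃ (T , t) (T , u)

  data C∃ {Γ} where
    c∃ : ∀ {T} {t u : Tm Γ T} → t >horco u → C∃ (T , t) (T , u)

  data _>whorco_ where
    rule : ∀ {Γ f Ts T} {s : Split (type f) Ts T} {l : Args Γ Ts} {u : Tm Γ T} →
           Gt f s l u →
           (∀ {A} (x : A ∈ Γ) → x ∈FV u → x ∈FV appS (fun f) s l) →
           appS (fun f) s l >whorco u

  data _>horco_ where
    cont-hole : ∀ {Γ T} {t u : Tm Γ T} → t >whorco u → t >horco u
    cont-appl : ∀ {Γ A B} {t u : Tm Γ (A ⇒ B)} {v : Tm Γ A} →
                t >horco u → app t v >horco app u v
    cont-appr : ∀ {Γ A B} {v : Tm Γ (A ⇒ B)} {t u : Tm Γ A} →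
                t >horco u → app v t >horco app v u
    cont-lam  : ∀ {Γ A B} {t u : Tm (A ∷ Γ) B} →
                t >horco u → lam t >horco lam u

  data Gt where
    gt-arg : ∀ {Γ f Ts T} {s : Split (type f) Ts T} {l : Args Γ Ts}
               {A} (p : A ∈ Ts) → Gt f s l (All.lookup l p)
    gt-decomp : ∀ {Γ f Ts T} {s : Split (type f) Ts T} {l : Args Γ Ts}
                  {g Us U} {s′ : Split (type g) Us U} {us : Args Γ Us} →
                Gt f s l (appS (fun g) s′ us) →
                ∀ {A} (i : A ∈ Us) → IsBase A →
                Gt f s l (All.lookup us i)
    gt-prec : ∀ {Γ f Ts T} {s : Split (type f) Ts T} {l : Args Γ Ts} {g} →
              f >F g → Gt f s l (fun g)
    gt-call : ∀ {Γ f Ts T} {s : Split (type f) Ts T} {l : Args Γ Ts}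
                {g Us U} (s′ : Split (type g) Us U) (us : Args Γ Us) →
              f ≃F g →
              (∀ {A} (i : A ∈ Us) → Gt f s l (All.lookup us i)) →
              StatExt W∃ (stat f) (toList l) (toList us) →
              Gt f s l (appS (fun g) s′ us)
    gt-call′ : ∀ {Γ f Ts T} {s : Split (type f) Ts T} {l : Args Γ Ts}
                 {g Us U} (s′ : Split (type g) Us U) (us : Args Γ Us) →
               f ≃F g →
               (∀ {A} (i : A ∈ Us) → Gt f s l (All.lookup us i)) →
               StatExt C∃ (stat f) (toList l) (toList us) →
               Gt f s l (appS (fun g) s′ us)
    gt-app : ∀ {Γ f Ts T} {s : Split (type f) Ts T} {l : Args Γ Ts}
               {V W} {u : Tm Γ (V ⇒ W)} {v : Tm Γ V} →
             Gt f s l u → Gt f s l v → Gt f s l (app u v)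
    gt-var : ∀ {Γ f Ts T} {s : Split (type f) Ts T} {l : Args Γ Ts}
               {A} (x : A ∈ Γ) → ¬ (x ∈FVs l) → Gt f s l (var x)
    -- (lam): the bound variable is fresh for l⃗ (it is not in Γ)
    gt-lam : ∀ {Γ f Ts T} {s : Split (type f) Ts T} {l : Args Γ Ts}
               {A B} {u : Tm (A ∷ Γ) B} →
             Gt f s (wkArgs l) u → Gt f s l (lam u)
    gt-red : ∀ {Γ f Ts T} {s : Split (type f) Ts T} {l : Args Γ Ts}
               {V} {u v : Tm Γ V} →
             Gt f s l u → u >horco v → Gt f s l v

  infix 4 _>horpo_ _≥horpo_

  data _>horpo_ : ∀ {Γ A B} → Tm Γ A → Tm Γ B → Set
  data _≥horpo_ : ∀ {Γ A B} → Tm Γ A → Tm Γ B → Set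
  data P : ∀ {Γ} (f : Sym) {Ts T} → Split (type f) Ts T → Args Γ Ts →
           ∀ {B} → Tm Γ B → Set
  data H∃ {Γ : Ctx} : Tm∃ Γ → Tm∃ Γ → Set

  data H∃ {Γ} where
    h∃ : ∀ {A B} {t : Tm Γ A} {u : Tm Γ B} → t >horpo u → H∃ (A , t) (B , u)

  data _≥horpo_ where
    ≥-refl : ∀ {Γ A} {t : Tm Γ A} → t ≥horpo t
    ≥-gt   : ∀ {Γ A B} {t : Tm Γ A} {u : Tm Γ B} → t >horpo u → t ≥horpo u

  data P where
    P-gt  : ∀ {Γ f Ts T} {s : Split (type f) Ts T} {t : Args Γ Ts} {B} {u : Tm Γ B} →
            appS (fun f) s t >horpo u → P f s t u
    P-arg : ∀ {Γ f Ts T} {s : Split (type f) Ts T} {t : Args Γ Ts} {B} {u : Tm Γ B}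
              {A} (j : A ∈ Ts) → All.lookup t j ≥horpo u → P f s t u

  data _>horpo_ where
    horpo-1 : ∀ {Γ f Ts T} (s : Split (type f) Ts T) (t : Args Γ Ts) {u : Tm Γ T}
                {A} (i : A ∈ Ts) → All.lookup t i ≥horpo u →
              appS (fun f) s t >horpo u
    horpo-2 : ∀ {Γ f Ts T} (s : Split (type f) Ts T) (t : Args Γ Ts)
                {g Us} (s′ : Split (type g) Us T) (u : Args Γ Us) →
              f >F g →
              (∀ {A} (i : A ∈ Us) → P f s t (All.lookup u i)) →
              appS (fun f) s t >horpo appS (fun g) s′ u
    horpo-3 : ∀ {Γ f Ts T} (s : Split (type f) Ts T) (t : Args Γ Ts)
                {g Us} (s′ : Split (type g) Us T) (u : Args Γ Us) →
              f ≃F g → stat f ≡ mul →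
              StatExt H∃ (stat f) (toList t) (toList u) →
              appS (fun f) s t >horpo appS (fun g) s′ u
    horpo-4 : ∀ {Γ f Ts T} (s : Split (type f) Ts T) (t : Args Γ Ts)
                {g Us} (s′ : Split (type g) Us T) (u : Args Γ Us) →
              f ≃F g → stat f ≡ lex →
              StatExt H∃ (stat f) (toList t) (toList u) →
              (∀ {A} (i : A ∈ Us) → P f s t (All.lookup u i)) →
              appS (fun f) s t >horpo appS (fun g) s′ u
    horpo-5 : ∀ {Γ f Ts T} (s : Split (type f) Ts T) (t : Args Γ Ts)
                {W Vs} (u₁ : Tm Γ W) (s′ : Split W Vs T) (us : Args Γ Vs) →
              P f s t u₁ →
              (∀ {A} (i : A ∈ Vs) → P f s t (All.lookup us i)) →
              appS (fun f) s t >horpo appS u₁ s′ us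
    horpo-6 : ∀ {Γ U V T} (t₁ : Tm Γ (U ⇒ T)) (t₂ : Tm Γ U)
                (u₁ : Tm Γ (V ⇒ T)) (u₂ : Tm Γ V) →
              MulExt H∃ ((_ , t₁) ∷ (_ , t₂) ∷ []) ((_ , u₁) ∷ (_ , u₂) ∷ []) →
              app t₁ t₂ >horpo app u₁ u₂
    horpo-7 : ∀ {Γ A B C} {t : Tm (A ∷ Γ) B} {u : Tm (A ∷ Γ) C} →
              t >horpo u → lam t >horpo lam u

-- Induction on the HORPO derivation, with the invariant  t ≻ u :  t and u have the same
-- type, t >horco⁺ u, and  f l > u  whenever t is a head prefix  f l₁ … lₖ  of a term  f l.
-- The last part turns a root step  f l >horpo u  into the HORCO step given by (rule); it
-- has to hold for all head prefixes because rule (6) splits  f l  into  (f l₁ … lₙ₋₁) lₙ.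
-- Status comparisons are simulated by (call′): every decreasing argument is replaced by
-- its first HORCO reduct, giving a one-step decrease in the status extension, and the
-- remaining reductions are performed afterwards by (red).

module Submission where

open import Defs
open import Function using (_∘_)
open import Data.Product using (Σ; ∃; _×_; _,_; -,_)
open import Data.Sum using (_⊎_; inj₁; inj₂)
import Data.Sum as Sum
open import Data.List using (List; []; _∷_; _++_)
open import Data.List.Properties using (++-assoc)
open import Data.List.Membership.Propositional using (_∈_; find; lose)
open import Data.List.Membership.Propositional.Properties using (∈-++⁺ˡ; ∈-++⁺ʳ; ∈-++⁻)
open import Data.List.Relation.Unary.Any using (Any; here; there)
import Data.List.Relation.Unary.Any.Properties as Any
open import Data.List.Relation.Unary.All as All using (All; []; _∷_)
import Data.List.Relation.Unary.All.Properties as All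
open import Data.List.Relation.Binary.Pointwise as Pointwise using (Pointwise; []; _∷_)
open import Data.List.Relation.Binary.Subset.Propositional using (_⊆_)
open import Data.List.Relation.Binary.Subset.Propositional.Properties
  using (Any-resp-⊆; ⊆-trans; ⊆-reflexive; xs⊆xs++ys)
open import Data.List.Relation.Binary.Permutation.Propositional as ↭
  using (_↭_; ↭-sym; ↭-trans; ↭-reflexive)
open import Data.List.Relation.Binary.Permutation.Propositional.Properties
  using (Any-resp-↭; ∈-resp-↭; All-resp-↭; drop-∷; ↭-length; ↭-singleton-inv)
import Data.List.Relation.Binary.Permutation.Propositional.Properties as ↭ₚ
open import Relation.Binary.PropositionalEquality
  using (_≡_; refl; sym; trans; cong; subst; subst₂; module ≡-Reasoning)
open import Relation.Binary.Construct.Closure.Transitive as Transitive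
  using (TransClosure; [_]; _∷_)
open import Relation.Binary.Construct.Closure.ReflexiveTransitive as Star
  using (Star; ε; _◅_; _◅◅_)
open import Relation.Binary.Structures using (IsPreorder)

module _ {A B : Set} {R : A → A → Set} {S : B → B → Set}
         (f : A → B) (f-mono : ∀ {x y} → R x y → S (f x) (f y)) where

  TransClosure-gmap : ∀ {x y} → TransClosure R x y → TransClosure S (f x) (f y)
  TransClosure-gmap [ r ]    = [ f-mono r ]
  TransClosure-gmap (r ∷ rs) = f-mono r ∷ TransClosure-gmap rs

module _ {A : Set} where

  ≡++⇒⊆ : ∀ {xs ys zs : List A} → xs ≡ ys ++ zs → ys ⊆ xs
  ≡++⇒⊆ {ys = ys} {zs} eq = ⊆-trans (xs⊆xs++ys ys zs) (⊆-reflexive (sym eq))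

  ↭-pair-inv : ∀ {a b z x : A} → a ∷ b ∷ [] ↭ z ∷ x ∷ [] →
               (z ≡ a × x ≡ b) ⊎ (z ≡ b × x ≡ a)
  ↭-pair-inv p with ∈-resp-↭ (↭-sym p) (here refl)
  ... | here refl with refl ← ↭-singleton-inv (drop-∷ p) = inj₁ (refl , refl)
  ... | there (here refl)
    with refl ← ↭-singleton-inv (drop-∷ (↭-trans (↭.swap _ _ ↭.refl) p)) = inj₂ (refl , refl)

  ↭-transport : ∀ {S : A → A → Set} {xs ys ys′} → xs ↭ ys → Pointwise S ys′ ys →
                ∃ λ xs′ → xs′ ↭ ys′ × Pointwise S xs′ xs
  ↭-transport ↭.refl ps = -, ↭.refl , ps
  ↭-transport (↭.prep _ p) (r ∷ ps) with ↭-transport p ps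
  ... | _ , q , qs = -, ↭.prep _ q , r ∷ qs
  ↭-transport (↭.swap _ _ p) (r ∷ r′ ∷ ps) with ↭-transport p ps
  ... | _ , q , qs = -, ↭.swap _ _ q , r′ ∷ r ∷ qs
  ↭-transport (↭.trans p q) ps with ↭-transport q ps
  ... | _ , q′ , qs with ↭-transport p qs
  ... | _ , p′ , ps′ = -, ↭.trans p′ q′ , ps′

module _ {A : Set} {R : A → A → Set} where

  TransClosure⇒Star : ∀ {x y} → TransClosure R x y → Star R x y
  TransClosure⇒Star [ r ]    = r ◅ ε
  TransClosure⇒Star (r ∷ rs) = r ◅ TransClosure⇒Star rs

  TransClosure-uncons : ∀ {x y} → TransClosure R x y → ∃ λ w → R x w × Star R w y
  TransClosure-uncons [ r ]    = -, r , ε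
  TransClosure-uncons (r ∷ rs) = -, r , TransClosure⇒Star rs

  LexExt-++ˡ : ∀ zs {xs ys} → LexExt R xs ys → LexExt R (zs ++ xs) (zs ++ ys)
  LexExt-++ˡ []       lx = lx
  LexExt-++ˡ (z ∷ zs) lx = lex-there (LexExt-++ˡ zs lx)

  LexExt-++ʳ : ∀ {xs ys} zs → LexExt R xs ys → LexExt R (xs ++ zs) ys
  LexExt-++ʳ zs (lex-here r)   = lex-here r
  LexExt-++ʳ zs (lex-there lx) = lex-there (LexExt-++ʳ zs lx)

  MulExt-++ʳ : ∀ {xs ys} zs → MulExt R xs ys → MulExt R (xs ++ zs) ys
  MulExt-++ʳ zs (mulExt x X Y Z xs↭ ys↭ dom) =
    mulExt x (X ++ zs) Y Z
      (↭-trans (↭ₚ.++⁺ʳ zs xs↭) (↭-reflexive (++-assoc Z (x ∷ X) zs)))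
      ys↭ (All.map Any.++⁺ˡ dom)

  StatExt-++ʳ : ∀ {st xs ys} zs → StatExt R st xs ys → StatExt R st (xs ++ zs) ys
  StatExt-++ʳ zs (stat-lex lx) = stat-lex (LexExt-++ʳ zs lx)
  StatExt-++ʳ zs (stat-mul mx) = stat-mul (MulExt-++ʳ zs mx)

  StatExt-decrease-last : ∀ st zs {x y} rs → R x y → StatExt R st (zs ++ x ∷ rs) (zs ++ y ∷ [])
  StatExt-decrease-last lex zs rs r = stat-lex (LexExt-++ˡ zs (lex-here r))
  StatExt-decrease-last mul zs {x} {y} rs r =
    stat-mul (mulExt x rs (y ∷ []) zs ↭.refl ↭.refl (here r ∷ []))

  StatExt⇒MulExt : ∀ {st xs ys} → st ≡ mul → StatExt R st xs ys → MulExt R xs ys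
  StatExt⇒MulExt refl (stat-mul mx) = mx

  StatExt⇒LexExt : ∀ {st xs ys} → st ≡ lex → StatExt R st xs ys → LexExt R xs ys
  StatExt⇒LexExt refl (stat-lex lx) = lx

  MulExt⇒StatExt : ∀ {st xs ys} → st ≡ mul → MulExt R xs ys → StatExt R st xs ys
  MulExt⇒StatExt refl = stat-mul

  LexExt⇒StatExt : ∀ {st xs ys} → st ≡ lex → LexExt R xs ys → StatExt R st xs ys
  LexExt⇒StatExt refl = stat-lex

  data PairMulExt (a b c d : A) : Set where
    replace-both : Any (λ x → R x c) (a ∷ b ∷ []) → Any (λ x → R x d) (a ∷ b ∷ []) →
                   PairMulExt a b c d
    keepˡˡ : a ≡ c → R b d → PairMulExt a b c d
    keepˡʳ : a ≡ d → R b c → PairMulExt a b c d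
    keepʳˡ : b ≡ c → R a d → PairMulExt a b c d
    keepʳʳ : b ≡ d → R a c → PairMulExt a b c d

  MulExt-pair⁻ : ∀ {a b c d} → MulExt R (a ∷ b ∷ []) (c ∷ d ∷ []) → PairMulExt a b c d
  MulExt-pair⁻ (mulExt x X Y [] ab↭ cd↭ dom) =
    replace-both (dominator (here refl)) (dominator (there (here refl)))
    where
    dominator : ∀ {y} → y ∈ _ ∷ _ ∷ [] → Any (λ x′ → R x′ y) (_ ∷ _ ∷ [])
    dominator y∈ = Any-resp-↭ (↭-sym ab↭) (All.lookup dom (Any-resp-↭ cd↭ y∈))
  MulExt-pair⁻ (mulExt x [] (y ∷ []) (z ∷ []) ab↭ cd↭ (here r ∷ []))
    with ↭-pair-inv ab↭ | ↭-pair-inv cd↭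
  ... | inj₁ (refl , refl) | inj₁ (refl , refl) = keepˡˡ refl r
  ... | inj₁ (refl , refl) | inj₂ (refl , refl) = keepˡʳ refl r
  ... | inj₂ (refl , refl) | inj₁ (refl , refl) = keepʳˡ refl r
  ... | inj₂ (refl , refl) | inj₂ (refl , refl) = keepʳʳ refl r
  MulExt-pair⁻ (mulExt x [] (y ∷ []) (z ∷ []) _ _ (there () ∷ []))
  MulExt-pair⁻ (mulExt x [] [] (z ∷ []) _ cd↭ _) with ↭-length cd↭
  ... | ()
  MulExt-pair⁻ (mulExt x [] (_ ∷ _ ∷ _) (z ∷ []) _ cd↭ _) with ↭-length cd↭
  ... | ()
  MulExt-pair⁻ (mulExt x (_ ∷ _) Y (z ∷ []) ab↭ _ _) with ↭-length ab↭
  ... | ()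
  MulExt-pair⁻ (mulExt x X Y (_ ∷ _ ∷ []) ab↭ _ _) with ↭-length ab↭
  ... | ()
  MulExt-pair⁻ (mulExt x X Y (_ ∷ _ ∷ _ ∷ _) ab↭ _ _) with ↭-length ab↭
  ... | ()

module Proof (S : Signature) where
  open Signature S
  open Theory S

  infix 4 _>horco*_ _>horco⁺_ _>horco*∃_ _>args*_ _⊆FV_ _≻_ _≽_ _≻∃_

  _>horco*_ : ∀ {Γ T} → Tm Γ T → Tm Γ T → Set
  _>horco*_ {Γ} {T} = Star (_>horco_ {Γ} {T})

  _>horco⁺_ : ∀ {Γ T} → Tm Γ T → Tm Γ T → Set
  _>horco⁺_ {Γ} {T} = TransClosure (_>horco_ {Γ} {T})

  data _>horco*∃_ {Γ} : Tm∃ Γ → Tm∃ Γ → Set where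
    ∃* : ∀ {T} {t u : Tm Γ T} → t >horco* u → (T , t) >horco*∃ (T , u)

  >horco*∃-refl : ∀ {Γ} (e : Tm∃ Γ) → e >horco*∃ e
  >horco*∃-refl (_ , t) = ∃* ε

  ReductIn : ∀ {Γ} → List (Tm∃ Γ) → Tm∃ Γ → Set
  ReductIn K e = Any (_>horco*∃ e) K

  ≃F-refl : ∀ {f} → f ≃F f
  ≃F-refl = IsPreorder.refl ≥F-isPreorder , IsPreorder.refl ≥F-isPreorder

  appS-congʰ : ∀ {Γ U Ts T} {h h′ : Tm Γ U} (s : Split U Ts T) (l : Args Γ Ts) →
               h >horco h′ → appS h s l >horco appS h′ s l
  appS-congʰ done    []      r = r
  appS-congʰ (arg s) (a ∷ l) r = appS-congʰ s l (cont-appl r)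

  data _>args*_ {Γ} : ∀ {Ts} → Args Γ Ts → Args Γ Ts → Set where
    []  : [] >args* []
    _∷_ : ∀ {A Ts} {t u : Tm Γ A} {ts us : Args Γ Ts} →
          t >horco* u → ts >args* us → (t ∷ ts) >args* (u ∷ us)

  >args*-refl : ∀ {Γ Ts} (ts : Args Γ Ts) → ts >args* ts
  >args*-refl []       = []
  >args*-refl (t ∷ ts) = ε ∷ >args*-refl ts

  appS-cong* : ∀ {Γ U Ts T} (h : Tm Γ U) (s : Split U Ts T) {ts us : Args Γ Ts} →
               ts >args* us → appS h s ts >horco* appS h s us
  appS-cong* h done    []                           = ε
  appS-cong* h (arg s) (_∷_ {us = us} t>*u ts>*us) =
    appS-cong* (app h _) s ts>*us ◅◅
    Star.gmap (λ v → appS v s us) (appS-congʰ s us) (Star.gmap (app h) cont-appr t>*u)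

  Split-∷ʳ : ∀ {U Us A B} → Split U Us (A ⇒ B) → Split U (Us ++ A ∷ []) B
  Split-∷ʳ done    = arg done
  Split-∷ʳ (arg s) = arg (Split-∷ʳ s)

  appS-∷ʳ : ∀ {Γ U Us A B} (h : Tm Γ U) (s : Split U Us (A ⇒ B)) (us : Args Γ Us)
            (a : Tm Γ A) → appS h (Split-∷ʳ s) (All.∷ʳ⁺ us a) ≡ app (appS h s us) a
  appS-∷ʳ h done    []       a = refl
  appS-∷ʳ h (arg s) (u ∷ us) a = appS-∷ʳ (app h u) s us a

  toList-∷ʳ : ∀ {Γ Us A} (us : Args Γ Us) (a : Tm Γ A) →
              toList (All.∷ʳ⁺ us a) ≡ toList us ++ (A , a) ∷ []
  toList-∷ʳ []       a = refl
  toList-∷ʳ (u ∷ us) a = cong (_ ∷_) (toList-∷ʳ us a)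

  lookup∈toList : ∀ {Γ Ts A} (l : Args Γ Ts) (j : A ∈ Ts) → (A , All.lookup l j) ∈ toList l
  lookup∈toList (a ∷ l) (here refl) = here refl
  lookup∈toList (a ∷ l) (there j)   = there (lookup∈toList l j)

  ∈toList⇒lookup : ∀ {Γ Ts A} (l : Args Γ Ts) {t : Tm Γ A} → (A , t) ∈ toList l →
                   ∃ λ (j : A ∈ Ts) → All.lookup l j ≡ t
  ∈toList⇒lookup (a ∷ l) (here refl) = here refl , refl
  ∈toList⇒lookup (a ∷ l) (there t∈l) with ∈toList⇒lookup l t∈l
  ... | j , lⱼ≡t = there j , lⱼ≡t

  _⊆FV_ : ∀ {Γ A B} → Tm Γ A → Tm Γ B → Set
  _⊆FV_ {Γ} u t = ∀ {C} (x : C ∈ Γ) → x ∈FV u → x ∈FV t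

  ⊆FV-trans : ∀ {Γ A B C} {t : Tm Γ A} {u : Tm Γ B} {v : Tm Γ C} →
              v ⊆FV u → u ⊆FV t → v ⊆FV t
  ⊆FV-trans v⊆u u⊆t x = u⊆t x ∘ v⊆u x

  fun-⊆FV : ∀ {Γ A g} {t : Tm Γ A} → fun g ⊆FV t
  fun-⊆FV x ()

  horco-⊆FV : ∀ {Γ T} {t u : Tm Γ T} → t >horco u → u ⊆FV t
  horco-⊆FV (cont-hole (rule _ fv)) x x∈u           = fv x x∈u
  horco-⊆FV (cont-appl t>u)         x (fv-appl x∈u) = fv-appl (horco-⊆FV t>u x x∈u)
  horco-⊆FV (cont-appl t>u)         x (fv-appr x∈v) = fv-appr x∈v
  horco-⊆FV (cont-appr t>u)         x (fv-appl x∈v) = fv-appl x∈v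
  horco-⊆FV (cont-appr t>u)         x (fv-appr x∈u) = fv-appr (horco-⊆FV t>u x x∈u)
  horco-⊆FV (cont-lam t>u)          x (fv-lam x∈u)  = fv-lam (horco-⊆FV t>u (there x) x∈u)

  horco*-⊆FV : ∀ {Γ T} {t u : Tm Γ T} → t >horco* u → u ⊆FV t
  horco*-⊆FV ε            x x∈u = x∈u
  horco*-⊆FV (t>v ◅ v>*u) x x∈u = horco-⊆FV t>v x (horco*-⊆FV v>*u x x∈u)

  head-⊆FV-appS : ∀ {Γ U Ts T} (h : Tm Γ U) (s : Split U Ts T) (l : Args Γ Ts) →
                  h ⊆FV appS h s l
  head-⊆FV-appS h done    []      x x∈h = x∈h
  head-⊆FV-appS h (arg s) (a ∷ l) x x∈h = head-⊆FV-appS (app h a) s l x (fv-appl x∈h)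

  lookup-⊆FV-appS : ∀ {Γ U Ts T A} (h : Tm Γ U) (s : Split U Ts T) (l : Args Γ Ts)
                    (j : A ∈ Ts) → All.lookup l j ⊆FV appS h s l
  lookup-⊆FV-appS h (arg s) (a ∷ l) (here refl) x x∈a =
    head-⊆FV-appS (app h a) s l x (fv-appr x∈a)
  lookup-⊆FV-appS h (arg s) (a ∷ l) (there j)   x x∈l =
    lookup-⊆FV-appS (app h a) s l j x x∈l

  appS-⊆FV : ∀ {Γ U Ts T B} {t : Tm Γ B} {h : Tm Γ U} (s : Split U Ts T) (l : Args Γ Ts) →
             h ⊆FV t → (∀ {A} (j : A ∈ Ts) → All.lookup l j ⊆FV t) → appS h s l ⊆FV t
  appS-⊆FV done    []      h⊆t l⊆t = h⊆t
  appS-⊆FV {t = t} {h} (arg s) (a ∷ l) h⊆t l⊆t = appS-⊆FV s l ha⊆t (l⊆t ∘ there)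
    where
    ha⊆t : app h a ⊆FV t
    ha⊆t x (fv-appl x∈h) = h⊆t x x∈h
    ha⊆t x (fv-appr x∈a) = l⊆t (here refl) x x∈a

  reductIn-⊆FV : ∀ {Γ f Ts T B} (s : Split (type f) Ts T) (l : Args Γ Ts) {v : Tm Γ B} →
                 ReductIn (toList l) (B , v) → v ⊆FV appS (fun f) s l
  reductIn-⊆FV s l red with find red
  ... | _ , t∈l , ∃* t>*v with ∈toList⇒lookup l t∈l
  ... | j , refl = ⊆FV-trans (horco*-⊆FV t>*v) (lookup-⊆FV-appS (fun _) s l j)

  Gt-red* : ∀ {Γ f Ts T} {s : Split (type f) Ts T} {l : Args Γ Ts} {B} {u v : Tm Γ B} →
            Gt f s l u → u >horco* v → Gt f s l v
  Gt-red* gt ε            = gt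
  Gt-red* gt (u>w ◅ w>*v) = Gt-red* (gt-red gt u>w) w>*v

  Gt-∈args : ∀ {Γ f Ts T} {s : Split (type f) Ts T} {l : Args Γ Ts} {B} {v : Tm Γ B} →
             (B , v) ∈ toList l → Gt f s l v
  Gt-∈args {l = l} v∈l with ∈toList⇒lookup l v∈l
  ... | j , refl = gt-arg j

  Gt-reductIn : ∀ {Γ f Ts T} {s : Split (type f) Ts T} {l : Args Γ Ts} {B} {v : Tm Γ B} →
                ReductIn (toList l) (B , v) → Gt f s l v
  Gt-reductIn red with find red
  ... | _ , t∈l , ∃* t>*v = Gt-red* (Gt-∈args t∈l) t>*v

  Gt-appS : ∀ {Γ f Ts T} {s : Split (type f) Ts T} {l : Args Γ Ts} {V Us W} {h : Tm Γ V} →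
            Gt f s l h → (s′ : Split V Us W) (us : Args Γ Us) →
            (∀ {A} (i : A ∈ Us) → Gt f s l (All.lookup us i)) → Gt f s l (appS h s′ us)
  Gt-appS gt done      []       gt-us = gt
  Gt-appS gt (arg s′) (u ∷ us) gt-us =
    Gt-appS (gt-app gt (gt-us (here refl))) s′ us (gt-us ∘ there)

  -- Head prefixes:  Prefix s l t Rs sr rs  says  t = f l₁ … lₖ  and  t rs = f l  along  sr.
  data Prefix {Γ f Ts T} (s : Split (type f) Ts T) (l : Args Γ Ts) :
              ∀ {U} → Tm Γ U → (Rs : List Type) → Split U Rs T → Args Γ Rs → Set where
    prefix-fun : Prefix s l (fun f) Ts s l
    prefix-app : ∀ {A B Rs} {t : Tm Γ (A ⇒ B)} {a : Tm Γ A} {sr : Split B Rs T}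
                   {rs : Args Γ Rs} →
                 Prefix s l t (A ∷ Rs) (arg sr) (a ∷ rs) → Prefix s l (app t a) Rs sr rs

  module _ {Γ f Ts T} {s : Split (type f) Ts T} {l : Args Γ Ts} where

    prefix-appS : ∀ {U Rs} {t : Tm Γ U} (sr : Split U Rs T) (rs : Args Γ Rs) →
                  Prefix s l t Rs sr rs → Prefix s l (appS t sr rs) [] done []
    prefix-appS done      []       p = p
    prefix-appS (arg sr) (a ∷ rs) p = prefix-appS sr rs (prefix-app p)

    prefix-appS⁻ : ∀ {V Us U Rs} (h : Tm Γ V) (s′ : Split V Us U) (l′ : Args Γ Us)
                   {sr : Split U Rs T} {rs : Args Γ Rs} → Prefix s l (appS h s′ l′) Rs sr rs →
                   ∃ λ Xs → Σ (Split V Xs T) λ sx → Σ (Args Γ Xs) λ xs →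
                     Prefix s l h Xs sx xs × toList xs ≡ toList l′ ++ toList rs
    prefix-appS⁻ h done      []       p = -, -, -, p , refl
    prefix-appS⁻ h (arg s′) (a ∷ l′) p with prefix-appS⁻ (app h a) s′ l′ p
    ... | _ , _ , _ , prefix-app p′ , xs≡ = -, -, -, p′ , cong (_ ∷_) xs≡

    prefix-fun⁻ : ∀ {g Xs} {sx : Split (type g) Xs T} {xs : Args Γ Xs} →
                  Prefix s l (fun g) Xs sx xs → g ≡ f × toList xs ≡ toList l
    prefix-fun⁻ prefix-fun = refl , refl

    prefix-appS-fun⁻ : ∀ {g Us U Rs} (s′ : Split (type g) Us U) (l′ : Args Γ Us)
                       {sr : Split U Rs T} {rs : Args Γ Rs} →
                       Prefix s l (appS (fun g) s′ l′) Rs sr rs →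
                       g ≡ f × toList l ≡ toList l′ ++ toList rs
    prefix-appS-fun⁻ {g} s′ l′ p with prefix-appS⁻ (fun g) s′ l′ p
    ... | _ , _ , _ , p′ , xs≡ with prefix-fun⁻ p′
    ... | refl , xs≡l = refl , trans (sym xs≡l) xs≡

    prefix-view : ∀ {U Rs} {t : Tm Γ U} {sr : Split U Rs T} {rs : Args Γ Rs} →
                  Prefix s l t Rs sr rs →
                  ∃ λ Us → Σ (Split (type f) Us U) λ s₀ → Σ (Args Γ Us) λ us →
                    t ≡ appS (fun f) s₀ us × toList us ++ toList rs ≡ toList l
    prefix-view prefix-fun = -, done , [] , refl , refl
    prefix-view {rs = rs} (prefix-app {A = A} {a = a} p) with prefix-view p
    ... | _ , s₀ , us , refl , us++a∷rs≡l =
      -, Split-∷ʳ s₀ , All.∷ʳ⁺ us a , sym (appS-∷ʳ (fun f) s₀ us a) ,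
      (begin
        toList (All.∷ʳ⁺ us a) ++ toList rs       ≡⟨ cong (_++ toList rs) (toList-∷ʳ us a) ⟩
        (toList us ++ (A , a) ∷ []) ++ toList rs ≡⟨ ++-assoc (toList us) _ (toList rs) ⟩
        toList us ++ (A , a) ∷ toList rs         ≡⟨ us++a∷rs≡l ⟩
        toList l                                 ∎)
      where open ≡-Reasoning

    prefix-next-∈ : ∀ {A B Rs} {t : Tm Γ (A ⇒ B)} {a : Tm Γ A} {sr : Split B Rs T}
                      {rs : Args Γ Rs} →
                    Prefix s l t (A ∷ Rs) (arg sr) (a ∷ rs) → (A , a) ∈ toList l
    prefix-next-∈ p with prefix-view p
    ... | _ , _ , us , _ , us++a∷rs≡l =
      subst (_ ∈_) us++a∷rs≡l (∈-++⁺ʳ (toList us) (here refl))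

  PrefixGt : ∀ {Γ A B} → Tm Γ A → Tm Γ B → Set
  PrefixGt {Γ} {A} t u = ∀ {f Ts T} {s : Split (type f) Ts T} {l : Args Γ Ts} {Rs}
                           {sr : Split A Rs T} {rs : Args Γ Rs} → Prefix s l t Rs sr rs → Gt f s l u

  data _≻_ {Γ} : ∀ {A B} → Tm Γ A → Tm Γ B → Set where
    ≻-intro : ∀ {A} {t u : Tm Γ A} → t >horco⁺ u → PrefixGt t u → t ≻ u

  data _≽_ {Γ} : ∀ {A B} → Tm Γ A → Tm Γ B → Set where
    ≽-refl : ∀ {A} {t : Tm Γ A} → t ≽ t
    ≽-≻    : ∀ {A B} {t : Tm Γ A} {u : Tm Γ B} → t ≻ u → t ≽ u

  data _≻∃_ {Γ} : Tm∃ Γ → Tm∃ Γ → Set where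
    ≻∃-intro : ∀ {A} {t u : Tm Γ A} → t ≻ u → (A , t) ≻∃ (A , u)

  ≻⇒≻∃ : ∀ {Γ A B} {t : Tm Γ A} {u : Tm Γ B} → t ≻ u → (A , t) ≻∃ (B , u)
  ≻⇒≻∃ (≻-intro t>⁺u gt) = ≻∃-intro (≻-intro t>⁺u gt)

  data P≻ {Γ} (f : Sym) {Ts T} (s : Split (type f) Ts T) (l : Args Γ Ts) :
          ∀ {B} → Tm Γ B → Set where
    P≻-gt  : ∀ {B} {v : Tm Γ B} → appS (fun f) s l ≻ v → P≻ f s l v
    P≻-arg : ∀ {A B} {v : Tm Γ B} (j : A ∈ Ts) → All.lookup l j ≽ v → P≻ f s l v

  Gt-≽ : ∀ {Γ f Ts T} {s : Split (type f) Ts T} {l : Args Γ Ts} {A B} {t : Tm Γ A}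
           {u : Tm Γ B} → Gt f s l t → t ≽ u → Gt f s l u
  Gt-≽ gt ≽-refl                 = gt
  Gt-≽ gt (≽-≻ (≻-intro t>⁺u _)) = Gt-red* gt (TransClosure⇒Star t>⁺u)

  ≽-⊆FV : ∀ {Γ A B} {t : Tm Γ A} {u : Tm Γ B} → t ≽ u → u ⊆FV t
  ≽-⊆FV ≽-refl                 x x∈t = x∈t
  ≽-⊆FV (≽-≻ (≻-intro t>⁺u _)) = horco*-⊆FV (TransClosure⇒Star t>⁺u)

  P≻-⊆FV : ∀ {Γ f Ts T B} {s : Split (type f) Ts T} {l : Args Γ Ts} {v : Tm Γ B} →
           P≻ f s l v → v ⊆FV appS (fun f) s l
  P≻-⊆FV (P≻-gt t≻v)                = ≽-⊆FV (≽-≻ t≻v)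
  P≻-⊆FV {s = s} {l} (P≻-arg j lⱼ≽v) =
    ⊆FV-trans (≽-⊆FV lⱼ≽v) (lookup-⊆FV-appS (fun _) s l j)

  P≻-Gt : ∀ {Γ f Ts T} {s : Split (type f) Ts T} {l : Args Γ Ts} {Us U Rs}
            {s₀ : Split (type f) Us U} {l₀ : Args Γ Us} {sr : Split U Rs T} {rs : Args Γ Rs}
            {B} {v : Tm Γ B} →
          Prefix s l (appS (fun f) s₀ l₀) Rs sr rs → toList l₀ ⊆ toList l →
          P≻ f s₀ l₀ v → Gt f s l v
  P≻-Gt pre l₀⊆l (P≻-gt (≻-intro _ gt))    = gt pre
  P≻-Gt {l₀ = l₀} pre l₀⊆l (P≻-arg j lⱼ≽v) =
    Gt-≽ (Gt-∈args (l₀⊆l (lookup∈toList l₀ j))) lⱼ≽v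

  Gt-call′* : ∀ {Γ f Ts T} {s : Split (type f) Ts T} {l : Args Γ Ts}
                {g Us U} (s′ : Split (type g) Us U) {L₀ R : List (Tm∃ Γ)} {w u : Args Γ Us} →
              f ≃F g → toList l ≡ L₀ ++ R → StatExt C∃ (stat f) L₀ (toList w) →
              (∀ {A} (i : A ∈ Us) → Gt f s l (All.lookup w i)) → w >args* u →
              Gt f s l (appS (fun g) s′ u)
  Gt-call′* {f = f} s′ {R = R} {w} f≃g l≡ L₀>w gt-w w>*u =
    Gt-red* (gt-call′ s′ w f≃g gt-w
                      (subst (λ L → StatExt C∃ (stat f) L (toList w)) (sym l≡)
                             (StatExt-++ʳ R L₀>w)))
            (appS-cong* (fun _) s′ w>*u)

  ≻-rule : ∀ {Γ f Ts T} (s : Split (type f) Ts T) (l : Args Γ Ts) {u : Tm Γ T} →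
           PrefixGt (appS (fun f) s l) u → u ⊆FV appS (fun f) s l → appS (fun f) s l ≻ u
  ≻-rule s l gt fv = ≻-intro [ cont-hole (rule (gt (prefix-appS s l prefix-fun)) fv) ] gt

  firstStep : ∀ {Γ} {K : List (Tm∃ Γ)} {y} → Any (_≻∃ y) K →
              ∃ λ y′ → y′ >horco*∃ y × Any (λ x → C∃ x y′) K × ReductIn K y′
  firstStep (here (≻∃-intro (≻-intro x>⁺y _))) with TransClosure-uncons x>⁺y
  ... | y′ , x>y′ , y′>*y = -, ∃* y′>*y , here (c∃ x>y′) , here (∃* (x>y′ ◅ ε))
  firstStep (there dom) with firstStep dom
  ... | y′ , y′>*y , dom′ , red = y′ , y′>*y , there dom′ , there red

  firstSteps : ∀ {Γ} {K Y : List (Tm∃ Γ)} → All (λ y → Any (_≻∃ y) K) Y →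
               ∃ λ Y′ → Pointwise _>horco*∃_ Y′ Y ×
                 All (λ y′ → Any (λ x → C∃ x y′) K) Y′ × All (ReductIn K) Y′
  firstSteps []           = [] , [] , [] , []
  firstSteps (dom ∷ doms) with firstStep dom | firstSteps doms
  ... | y′ , y′>*y , dom′ , red | Y′ , Y′>*Y , doms′ , reds =
    y′ ∷ Y′ , y′>*y ∷ Y′>*Y , dom′ ∷ doms′ , red ∷ reds

  args-of-reducts : ∀ {Γ Us} {L : List (Tm∃ Γ)} (u : Args Γ Us) →
                    Pointwise _>horco*∃_ L (toList u) →
                    ∃ λ (w : Args Γ Us) → toList w ≡ L × w >args* u
  args-of-reducts []      []                = [] , refl , []
  args-of-reducts (a ∷ u) (∃* w₀>*a ∷ L>*u) with args-of-reducts u L>*u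
  ... | w , refl , w>*u = _ ∷ w , refl , w₀>*a ∷ w>*u

  mulExt-firstSteps : ∀ {Γ Us} {M : List (Tm∃ Γ)} (u : Args Γ Us) →
                      MulExt _≻∃_ M (toList u) →
                      ∃ λ (w : Args Γ Us) →
                        MulExt C∃ M (toList w) × w >args* u × All (ReductIn M) (toList w)
  mulExt-firstSteps {M = M} u (mulExt x X Y Z M↭ u↭ dom) with firstSteps dom
  ... | Y′ , Y′>*Y , dom′ , redsY′
    with ↭-transport u↭ (Pointwise.++⁺ˡ (>horco*∃-refl _) Z Y′>*Y)
  ... | _ , w↭ , w>*u with args-of-reducts u w>*u
  ... | w , refl , w>*u′ =
    w , mulExt x X Y′ Z M↭ w↭ dom′ , w>*u′ ,
    All-resp-↭ (↭-sym w↭) (All.++⁺ (All.tabulate kept) (All.map (Any-resp-⊆ xX⊆M) redsY′))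
    where
    xX⊆M : x ∷ X ⊆ M
    xX⊆M = Any-resp-↭ (↭-sym M↭) ∘ ∈-++⁺ʳ Z
    kept : ∀ {z} → z ∈ Z → ReductIn M z
    kept z∈Z = lose (Any-resp-↭ (↭-sym M↭) (∈-++⁺ˡ z∈Z)) (>horco*∃-refl _)

  lexExt-firstSteps : ∀ {Γ Us} {M : List (Tm∃ Γ)} (u : Args Γ Us) →
                      LexExt _≻∃_ M (toList u) →
                      ∃ λ (w : Args Γ Us) → LexExt C∃ M (toList w) × w >args* u ×
                        (∀ {A} (i : A ∈ Us) →
                           All.lookup w i ≡ All.lookup u i ⊎ ReductIn M (A , All.lookup w i))
  lexExt-firstSteps (b ∷ u) (lex-here (≻∃-intro (≻-intro m>⁺b _)))
    with TransClosure-uncons m>⁺b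
  ... | m′ , m>m′ , m′>*b =
    m′ ∷ u , lex-here (c∃ m>m′) , m′>*b ∷ >args*-refl u ,
    λ { (here refl) → inj₂ (here (∃* (m>m′ ◅ ε))) ; (there i) → inj₁ refl }
  lexExt-firstSteps (b ∷ u) (lex-there M>u) with lexExt-firstSteps u M>u
  ... | w , M>w , w>*u , origin =
    b ∷ w , lex-there M>w , ε ∷ w>*u ,
    λ { (here refl) → inj₁ refl ; (there i) → Sum.map₂ there (origin i) }

  ≻-arg : ∀ {Γ f Ts T A} (s : Split (type f) Ts T) (l : Args Γ Ts) {u : Tm Γ T}
            (j : A ∈ Ts) → All.lookup l j ≽ u → appS (fun f) s l ≻ u
  ≻-arg {f = f} s l {u} j lⱼ≽u =
    ≻-rule s l gt (⊆FV-trans (≽-⊆FV lⱼ≽u) (lookup-⊆FV-appS (fun f) s l j))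
    where
    gt : PrefixGt (appS (fun f) s l) u
    gt pre with prefix-appS-fun⁻ s l pre
    ... | refl , l≡ = Gt-≽ (Gt-∈args (≡++⇒⊆ l≡ (lookup∈toList l j))) lⱼ≽u

  ≻-prec : ∀ {Γ f Ts T} (s : Split (type f) Ts T) (l : Args Γ Ts)
             {g Us} (s′ : Split (type g) Us T) (u : Args Γ Us) → f >F g →
           (∀ {A} (i : A ∈ Us) → P≻ f s l (All.lookup u i)) →
           appS (fun f) s l ≻ appS (fun g) s′ u
  ≻-prec {f = f} s l s′ u f>g Pu = ≻-rule s l gt (appS-⊆FV s′ u fun-⊆FV (P≻-⊆FV ∘ Pu))
    where
    gt : PrefixGt (appS (fun f) s l) _
    gt pre with prefix-appS-fun⁻ s l pre
    ... | refl , l≡ = Gt-appS (gt-prec f>g) s′ u (P≻-Gt pre (≡++⇒⊆ l≡) ∘ Pu)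

  ≻-mul : ∀ {Γ f Ts T} (s : Split (type f) Ts T) (l : Args Γ Ts)
            {g Us} (s′ : Split (type g) Us T) (u : Args Γ Us) → f ≃F g → stat f ≡ mul →
          StatExt _≻∃_ (stat f) (toList l) (toList u) → appS (fun f) s l ≻ appS (fun g) s′ u
  ≻-mul {f = f} s l {g} {Us} s′ u f≃g mulᶠ l≻u
    with mulExt-firstSteps u (StatExt⇒MulExt mulᶠ l≻u)
  ... | w , l>w , w>*u , reducts =
    ≻-rule s l gt (⊆FV-trans (horco*-⊆FV (appS-cong* (fun g) s′ w>*u))
                             (appS-⊆FV s′ w fun-⊆FV (reductIn-⊆FV s l ∘ reductAt)))
    where
    reductAt : ∀ {A} (i : A ∈ Us) → ReductIn (toList l) (A , All.lookup w i)
    reductAt i = All.lookup reducts (lookup∈toList w i)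
    gt : PrefixGt (appS (fun f) s l) (appS (fun g) s′ u)
    gt pre with prefix-appS-fun⁻ s l pre
    ... | refl , l≡ = Gt-call′* s′ f≃g l≡ (MulExt⇒StatExt mulᶠ l>w)
                                (Gt-reductIn ∘ Any-resp-⊆ (≡++⇒⊆ l≡) ∘ reductAt) w>*u

  ≻-lex : ∀ {Γ f Ts T} (s : Split (type f) Ts T) (l : Args Γ Ts)
            {g Us} (s′ : Split (type g) Us T) (u : Args Γ Us) → f ≃F g → stat f ≡ lex →
          StatExt _≻∃_ (stat f) (toList l) (toList u) →
          (∀ {A} (i : A ∈ Us) → P≻ f s l (All.lookup u i)) →
          appS (fun f) s l ≻ appS (fun g) s′ u
  ≻-lex {f = f} s l {g} {Us} s′ u f≃g lexᶠ l≻u Pu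
    with lexExt-firstSteps u (StatExt⇒LexExt lexᶠ l≻u)
  ... | w , l>w , w>*u , origin = ≻-rule s l gt (appS-⊆FV s′ u fun-⊆FV (P≻-⊆FV ∘ Pu))
    where
    gt : PrefixGt (appS (fun f) s l) (appS (fun g) s′ u)
    gt {s = s₁} {l₁} pre with prefix-appS-fun⁻ s l pre
    ... | refl , l≡ = Gt-call′* s′ f≃g l≡ (LexExt⇒StatExt lexᶠ l>w) gtAt w>*u
      where
      gtAt : ∀ {A} (i : A ∈ Us) → Gt f s₁ l₁ (All.lookup w i)
      gtAt i with origin i
      ... | inj₁ wᵢ≡uᵢ = subst (Gt f s₁ l₁) (sym wᵢ≡uᵢ) (P≻-Gt pre (≡++⇒⊆ l≡) (Pu i))
      ... | inj₂ red   = Gt-reductIn (Any-resp-⊆ (≡++⇒⊆ l≡) red)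

  ≻-appS : ∀ {Γ f Ts T} (s : Split (type f) Ts T) (l : Args Γ Ts)
             {W Vs} (u₁ : Tm Γ W) (s′ : Split W Vs T) (us : Args Γ Vs) → P≻ f s l u₁ →
           (∀ {A} (i : A ∈ Vs) → P≻ f s l (All.lookup us i)) →
           appS (fun f) s l ≻ appS u₁ s′ us
  ≻-appS {f = f} s l u₁ s′ us Pu₁ Pus =
    ≻-rule s l gt (appS-⊆FV s′ us (P≻-⊆FV Pu₁) (P≻-⊆FV ∘ Pus))
    where
    gt : PrefixGt (appS (fun f) s l) (appS u₁ s′ us)
    gt pre with prefix-appS-fun⁻ s l pre
    ... | refl , l≡ =
      Gt-appS (P≻-Gt pre (≡++⇒⊆ l≡) Pu₁) s′ us (P≻-Gt pre (≡++⇒⊆ l≡) ∘ Pus)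

  ≻-lam : ∀ {Γ A B C} {t : Tm (A ∷ Γ) B} {u : Tm (A ∷ Γ) C} → t ≻ u → lam t ≻ lam u
  ≻-lam (≻-intro t>⁺u _) = ≻-intro (TransClosure-gmap lam cont-lam t>⁺u) λ ()

  data AppDecrease {Γ T} : ∀ {U V} → Tm Γ (U ⇒ T) → Tm Γ U → Tm Γ (V ⇒ T) → Tm Γ V →
                           Set where
    decrease-arg  : ∀ {U} {t₁ : Tm Γ (U ⇒ T)} {t₂ u₂ : Tm Γ U} →
                    t₂ ≻ u₂ → AppDecrease t₁ t₂ t₁ u₂
    decrease-fun  : ∀ {U} {t₁ u₁ : Tm Γ (U ⇒ T)} {t₂ : Tm Γ U} →
                    t₁ ≻ u₁ → AppDecrease t₁ t₂ u₁ t₂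
    decrease-both : ∀ {U} {t₁ u₁ : Tm Γ (U ⇒ T)} {t₂ u₂ : Tm Γ U} →
                    t₁ ≻ u₁ → t₂ ≻ u₂ → AppDecrease t₁ t₂ u₁ u₂

  -- The cases missing below compare terms of types  U  and  U ⇒ T , or force such an equation.
  PairMulExt⇒AppDecrease : ∀ {Γ T U V} {t₁ : Tm Γ (U ⇒ T)} {t₂ : Tm Γ U}
                             {u₁ : Tm Γ (V ⇒ T)} {u₂ : Tm Γ V} →
                           PairMulExt {R = _≻∃_} (_ , t₁) (_ , t₂) (_ , u₁) (_ , u₂) →
                           AppDecrease t₁ t₂ u₁ u₂
  PairMulExt⇒AppDecrease
    (replace-both (here (≻∃-intro t₁≻u₁)) (there (here (≻∃-intro t₂≻u₂)))) =
    decrease-both t₁≻u₁ t₂≻u₂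
  PairMulExt⇒AppDecrease (replace-both (here (≻∃-intro _)) (here ()))
  PairMulExt⇒AppDecrease (replace-both (there (here (≻∃-intro _))) (here ()))
  PairMulExt⇒AppDecrease (replace-both (there (here (≻∃-intro _))) (there (here ())))
  PairMulExt⇒AppDecrease (replace-both _ (there (there ())))
  PairMulExt⇒AppDecrease (replace-both (there (there ())) _)
  PairMulExt⇒AppDecrease (keepˡˡ refl (≻∃-intro t₂≻u₂)) = decrease-arg t₂≻u₂
  PairMulExt⇒AppDecrease (keepˡʳ refl ())
  PairMulExt⇒AppDecrease (keepʳˡ refl ())
  PairMulExt⇒AppDecrease (keepʳʳ refl (≻∃-intro t₁≻u₁)) = decrease-fun t₁≻u₁

  app-horco⁺ : ∀ {Γ T U V} {t₁ : Tm Γ (U ⇒ T)} {t₂ : Tm Γ U} {u₁ : Tm Γ (V ⇒ T)}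
                 {u₂ : Tm Γ V} →
               AppDecrease t₁ t₂ u₁ u₂ → app t₁ t₂ >horco⁺ app u₁ u₂
  app-horco⁺ {t₁ = t₁} (decrease-arg (≻-intro t₂>⁺u₂ _)) =
    TransClosure-gmap (app t₁) cont-appr t₂>⁺u₂
  app-horco⁺ {t₂ = t₂} (decrease-fun (≻-intro t₁>⁺u₁ _)) =
    TransClosure-gmap (λ v → app v t₂) cont-appl t₁>⁺u₁
  app-horco⁺ {t₂ = t₂} {u₁ = u₁} (decrease-both (≻-intro t₁>⁺u₁ _) (≻-intro t₂>⁺u₂ _)) =
    TransClosure-gmap (λ v → app v t₂) cont-appl t₁>⁺u₁ Transitive.++
    TransClosure-gmap (app u₁) cont-appr t₂>⁺u₂

  -- With  t₁ = f us,  the term  f (us ++ [w])  for the first reduct w of  t₂  is  >  by (call′).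
  Gt-app-reduct : ∀ {Γ f Ts T} {s : Split (type f) Ts T} {l : Args Γ Ts} {A B Rs}
                    {t₁ : Tm Γ (A ⇒ B)} {t₂ u₂ : Tm Γ A} {sr : Split B Rs T} {rs : Args Γ Rs} →
                  Prefix s l t₁ (A ∷ Rs) (arg sr) (t₂ ∷ rs) → t₂ >horco⁺ u₂ →
                  Gt f s l (app t₁ u₂)
  Gt-app-reduct {f = f} {s = s} {l} {A} {rs = rs} pre t₂>⁺u₂
    with prefix-view pre | TransClosure-uncons t₂>⁺u₂
  ... | _ , s₀ , us , refl , l≡ | w , t₂>w , w>*u₂ =
    Gt-red* (subst (Gt f s l) (appS-∷ʳ (fun f) s₀ us w) Gt-fusw)
            (Star.gmap (app (appS (fun f) s₀ us)) cont-appr w>*u₂)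
    where
    reduct : ∀ {e} → e ∈ toList us ++ (A , w) ∷ [] → ReductIn (toList l) e
    reduct e∈ with ∈-++⁻ (toList us) e∈
    ... | inj₁ e∈us        = lose (subst (_ ∈_) l≡ (∈-++⁺ˡ e∈us)) (>horco*∃-refl _)
    ... | inj₂ (here refl) =
      lose (subst (_ ∈_) l≡ (∈-++⁺ʳ (toList us) (here refl))) (∃* (t₂>w ◅ ε))
    reductAt : ∀ {C} (i : C ∈ _) → ReductIn (toList l) (C , All.lookup (All.∷ʳ⁺ us w) i)
    reductAt {C} i = reduct (subst ((C , All.lookup (All.∷ʳ⁺ us w) i) ∈_) (toList-∷ʳ us w)
                                   (lookup∈toList (All.∷ʳ⁺ us w) i))
    Gt-fusw : Gt f s l (appS (fun f) (Split-∷ʳ s₀) (All.∷ʳ⁺ us w))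
    Gt-fusw = gt-call′ (Split-∷ʳ s₀) (All.∷ʳ⁺ us w) ≃F-refl (Gt-reductIn ∘ reductAt)
                (subst₂ (StatExt C∃ (stat f)) l≡ (sym (toList-∷ʳ us w))
                        (StatExt-decrease-last (stat f) (toList us) (toList rs) (c∃ t₂>w)))

  app-prefixGt : ∀ {Γ T U V} {t₁ : Tm Γ (U ⇒ T)} {t₂ : Tm Γ U} {u₁ : Tm Γ (V ⇒ T)}
                   {u₂ : Tm Γ V} →
                 AppDecrease t₁ t₂ u₁ u₂ → PrefixGt (app t₁ t₂) (app u₁ u₂)
  app-prefixGt (decrease-arg (≻-intro t₂>⁺u₂ _)) (prefix-app pre) = Gt-app-reduct pre t₂>⁺u₂
  app-prefixGt (decrease-fun (≻-intro _ gt₁)) (prefix-app pre) =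
    gt-app (gt₁ pre) (Gt-∈args (prefix-next-∈ pre))
  app-prefixGt (decrease-both (≻-intro _ gt₁) (≻-intro t₂>⁺u₂ _)) (prefix-app pre) =
    gt-app (gt₁ pre) (Gt-red* (Gt-∈args (prefix-next-∈ pre)) (TransClosure⇒Star t₂>⁺u₂))

  ≻-app : ∀ {Γ T U V} {t₁ : Tm Γ (U ⇒ T)} {t₂ : Tm Γ U} {u₁ : Tm Γ (V ⇒ T)} {u₂ : Tm Γ V} →
          MulExt _≻∃_ ((_ , t₁) ∷ (_ , t₂) ∷ []) ((_ , u₁) ∷ (_ , u₂) ∷ []) →
          app t₁ t₂ ≻ app u₁ u₂
  ≻-app t≻u = ≻-intro (app-horco⁺ d) (app-prefixGt d)
    where d = PairMulExt⇒AppDecrease (MulExt-pair⁻ t≻u)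

  horpo⇒≻ : ∀ {Γ A B} {t : Tm Γ A} {u : Tm Γ B} → t >horpo u → t ≻ u
  ≥horpo⇒≽ : ∀ {Γ A B} {t : Tm Γ A} {u : Tm Γ B} → t ≥horpo u → t ≽ u
  P⇒P≻ : ∀ {Γ f Ts T} {s : Split (type f) Ts T} {l : Args Γ Ts} {B} {v : Tm Γ B} →
         P f s l v → P≻ f s l v
  -- Monotonicity of the extensions, spelled out so that termination is structural.
  H∃⇒≻∃ : ∀ {Γ} {a b : Tm∃ Γ} → H∃ a b → a ≻∃ b
  H∃⇒≻∃-Any : ∀ {Γ} {y : Tm∃ Γ} {K} → Any (λ x → H∃ x y) K → Any (_≻∃ y) K
  H∃⇒≻∃-All : ∀ {Γ} {K Y : List (Tm∃ Γ)} → All (λ y → Any (λ x → H∃ x y) K) Y →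
              All (λ y → Any (_≻∃ y) K) Y
  H∃⇒≻∃-MulExt : ∀ {Γ} {K N : List (Tm∃ Γ)} → MulExt H∃ K N → MulExt _≻∃_ K N
  H∃⇒≻∃-LexExt : ∀ {Γ} {K N : List (Tm∃ Γ)} → LexExt H∃ K N → LexExt _≻∃_ K N
  H∃⇒≻∃-StatExt : ∀ {Γ st} {K N : List (Tm∃ Γ)} → StatExt H∃ st K N → StatExt _≻∃_ st K N

  horpo⇒≻ (horpo-1 s l j lⱼ≥u)                = ≻-arg s l j (≥horpo⇒≽ lⱼ≥u)
  horpo⇒≻ (horpo-2 s l s′ u f>g Pu)          = ≻-prec s l s′ u f>g (λ i → P⇒P≻ (Pu i))
  horpo⇒≻ (horpo-3 s l s′ u f≃g mulᶠ l>u)    = ≻-mul s l s′ u f≃g mulᶠ (H∃⇒≻∃-StatExt l>u)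
  horpo⇒≻ (horpo-4 s l s′ u f≃g lexᶠ l>u Pu) =
    ≻-lex s l s′ u f≃g lexᶠ (H∃⇒≻∃-StatExt l>u) (λ i → P⇒P≻ (Pu i))
  horpo⇒≻ (horpo-5 s l u₁ s′ us Pu₁ Pus)     =
    ≻-appS s l u₁ s′ us (P⇒P≻ Pu₁) (λ i → P⇒P≻ (Pus i))
  horpo⇒≻ (horpo-6 t₁ t₂ u₁ u₂ t>u)          = ≻-app (H∃⇒≻∃-MulExt t>u)
  horpo⇒≻ (horpo-7 t>u)                       = ≻-lam (horpo⇒≻ t>u)

  ≥horpo⇒≽ ≥-refl     = ≽-refl
  ≥horpo⇒≽ (≥-gt t>u) = ≽-≻ (horpo⇒≻ t>u)

  P⇒P≻ (P-gt t>v)    = P≻-gt (horpo⇒≻ t>v)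
  P⇒P≻ (P-arg j t≥v) = P≻-arg j (≥horpo⇒≽ t≥v)

  H∃⇒≻∃ (h∃ t>u) = ≻⇒≻∃ (horpo⇒≻ t>u)

  H∃⇒≻∃-Any (here h)  = here (H∃⇒≻∃ h)
  H∃⇒≻∃-Any (there a) = there (H∃⇒≻∃-Any a)

  H∃⇒≻∃-All []       = []
  H∃⇒≻∃-All (a ∷ as) = H∃⇒≻∃-Any a ∷ H∃⇒≻∃-All as

  H∃⇒≻∃-MulExt (mulExt x X Y Z M↭ N↭ dom) = mulExt x X Y Z M↭ N↭ (H∃⇒≻∃-All dom)

  H∃⇒≻∃-LexExt (lex-here h)   = lex-here (H∃⇒≻∃ h)
  H∃⇒≻∃-LexExt (lex-there lx) = lex-there (H∃⇒≻∃-LexExt lx)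

  H∃⇒≻∃-StatExt (stat-lex lx) = stat-lex (H∃⇒≻∃-LexExt lx)
  H∃⇒≻∃-StatExt (stat-mul mx) = stat-mul (H∃⇒≻∃-MulExt mx)

lemma13 : (S : Signature) → let open Theory S in
    ∀ {Γ A B} (t : Tm Γ A) (u : Tm Γ B) → t >horpo u →
    Σ (A ≡ B) (λ eq → TransClosure _>horco_ (subst (Tm Γ) eq t) u)
lemma13 S t u t>u with Proof.horpo⇒≻ S t>u
... | Proof.≻-intro t>⁺u _ = refl , t>⁺u
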